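{- Let $r$, $v$ and $u$ be three distinct vertices of a chordal graph $G$. If $v$ belongs to an induced path between $u$ and $r$, then every path between $u$ and $r$ contains either $v$ or a neighbor of $v$. Accordingly, $N[v]\setminus\{r,u\}$ separates $r$ from $u$ (every $u$–$r$ path has an interior vertex in $N[v]\setminus\{r,u\}$).
   Context: $N[v]$ is the closed neighborhood of $v$ (i.e., $v$ together with its neighbors). A graph is chordal if every cycle of length at least 4 has a chord. -}

module Defs where

open import Data.Nat using (ℕ; suc; _+_; _≤_; _<_)
open import Data.Fin using (Fin; toℕ)
open import Data.List using (List; []; _∷_; _++_; length; lookup)
open import Data.List.Relation.Unary.Unique.Propositional using (Unique)
open import Data.List.Membership.Propositional using (_∈_)
open import Data.Product using (Σ; _×_; ∃-syntax)
open import Data.Sum using (_⊎_)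
open import Relation.Binary.PropositionalEquality using (_≡_)
open import Relation.Nullary using (¬_)

record Graph (n : ℕ) : Set₁ where
  field
    Adj     : Fin n → Fin n → Set
    irrefl  : ∀ {x} → ¬ Adj x x
    sym     : ∀ {x y} → Adj x y → Adj y x

open Graph public

module _ {n : ℕ} (G : Graph n) where

  data Walk : List (Fin n) → Set where
    []  : Walk []
    [_] : ∀ x → Walk (x ∷ [])
    _∷_ : ∀ {x y xs} → Adj G x y → Walk (y ∷ xs) → Walk (x ∷ y ∷ xs)

  IsPath : List (Fin n) → Set
  IsPath xs = Walk xs × Unique xs

  pathSeq : Fin n → List (Fin n) → Fin n → List (Fin n)
  pathSeq a mid b = a ∷ (mid ++ b ∷ [])

  PathBetween : Fin n → Fin n → List (Fin n) → Set
  PathBetween a b mid = IsPath (pathSeq a mid b)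

  IsInducedPath : List (Fin n) → Set
  IsInducedPath xs = IsPath xs ×
    ((i j : Fin (length xs)) → suc (toℕ i) < toℕ j →
       ¬ Adj G (lookup xs i) (lookup xs j))

  IsCycle : List (Fin n) → Set
  IsCycle [] = Data.Empty.⊥
    where import Data.Empty
  IsCycle (x ∷ xs) = 3 ≤ length (x ∷ xs) × IsPath (x ∷ xs) ×
    ((l : Fin (length (x ∷ xs))) → suc (toℕ l) ≡ length (x ∷ xs) →
       Adj G (lookup (x ∷ xs) l) x)

  -- a chord: an edge between two vertices that are not consecutive on the cycle
  HasChord : List (Fin n) → Set
  HasChord xs = ∃[ i ] ∃[ j ]
    (suc (toℕ i) < toℕ j) × ¬ (toℕ i ≡ 0 × suc (toℕ j) ≡ length xs) ×
    Adj G (lookup xs i) (lookup xs j)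

  Chordal : Set
  Chordal = ∀ xs → IsCycle xs → 4 ≤ length xs → HasChord xs

  N[_] : Fin n → Fin n → Set
  N[ v ] w = (w ≡ v) ⊎ Adj G v w

{-# OPTIONS --safe #-}
-- Let a and b be the neighbours of v on the induced u–r path L. In a chordal graph, if a and b
-- are non-adjacent neighbours of v then every a–b walk meets N[v] ∖ {a, b}: shorten the walk to
-- a path; if it avoids v, closing it up through v gives a cycle of length ≥ 4, and its chord
-- either joins v to an interior vertex of the path or short-cuts the path. For a u–r path Q,
-- apply this to the walk from b along L to r, back along Q to u, and along L to a. As L is
-- induced, its only vertices in N[v] are a, v and b, so the vertex found is interior to Q.
module Submission where

open import Defs
open import Data.Nat using (ℕ; zero; suc; _+_; _∸_; _⊓_; _≤_; _<_; z≤n; s≤s)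
open import Data.Nat.Properties
  using (suc-injective; n<1+n; m<n⇒m<1+n; ≤-antisym; ≤-<-trans; ≮⇒≥; n≤1+n; ≤-pred; <⇒≢; ≤-refl; ≤-trans; ≤-reflexive; m≤n⇒m≤1+n; <⇒≤; m⊓n≤m; m∸n≤m; m+[n∸m]≡n; +-monoˡ-≤; +-monoˡ-<; module ≤-Reasoning)
open import Data.Fin using (Fin; toℕ)
import Data.Fin as Fin
open import Data.List using (List; []; _∷_; _++_; length; lookup; take; drop; reverse)
open import Data.List.Properties using (length-++; length-take; length-drop; unfold-reverse)
open import Data.List.Membership.Propositional using (_∈_)
open import Data.List.Relation.Binary.Subset.Propositional using (_⊆_)
open import Data.List.Relation.Binary.Subset.Propositional.Properties using (∷⁺ʳ)
open import Data.List.Relation.Unary.All.Properties using (¬Any⇒All¬)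
open import Data.List.Relation.Unary.Unique.Propositional.Properties using (drop⁺)
import Data.List.Membership.DecPropositional as DecMembership
open import Data.List.Relation.Unary.Any using (here; there)
open import Data.List.Relation.Unary.Any.Properties using (reverse⁻)
open import Data.List.Relation.Unary.All as All using ([])
open import Data.List.Relation.Unary.Unique.Propositional using (Unique; []; _∷_)
open import Data.Product using (_×_; ∃-syntax; _,_; proj₁; proj₂)
open import Data.Empty using (⊥-elim)
open import Function using (_∘_)
open import Relation.Nullary using (¬_; yes; no)
open import Relation.Binary.PropositionalEquality as ≡ using (_≡_; _≢_; refl; cong; cong₂; subst)
open import Induction.WellFounded using (Acc; acc)
open import Data.Nat.Induction using (<-wellFounded)
open import Data.Sum using (_⊎_; inj₁; inj₂; [_,_]′)
open import Data.List.Membership.Propositional.Properties using (∈-++⁻; ∈-++⁺ˡ)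

module _ {A : Set} where

  data At : List A → ℕ → A → Set where
    first : ∀ {x xs} → At (x ∷ xs) 0 x
    later : ∀ {x y xs i} → At xs i y → At (x ∷ xs) (suc i) y

  At⇒∈ : ∀ {xs i x} → At xs i x → x ∈ xs
  At⇒∈ first     = here refl
  At⇒∈ (later p) = there (At⇒∈ p)

  ∈⇒At : ∀ {xs x} → x ∈ xs → ∃[ i ] At xs i x
  ∈⇒At (here refl) = 0 , first
  ∈⇒At (there x∈xs) with i , p ← ∈⇒At x∈xs = suc i , later p

  At⇒< : ∀ {xs i x} → At xs i x → i < length xs
  At⇒< first     = s≤s z≤n
  At⇒< (later p) = s≤s (At⇒< p)

  <⇒At : ∀ xs {i} → i < length xs → ∃[ x ] At xs i x
  <⇒At (x ∷ xs) {zero}  _         = x , first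
  <⇒At (x ∷ xs) {suc i} (s≤s i<n) with y , p ← <⇒At xs i<n = y , later p

  At-functional : ∀ {xs i x y} → At xs i x → At xs i y → x ≡ y
  At-functional first     first     = refl
  At-functional (later p) (later q) = At-functional p q

  At-injective : ∀ {xs i j x} → Unique xs → At xs i x → At xs j x → i ≡ j
  At-injective _          first     first     = refl
  At-injective (x∉ ∷ _)   first     (later q) = ⊥-elim (All.lookup x∉ (At⇒∈ q) refl)
  At-injective (x∉ ∷ _)   (later p) first     = ⊥-elim (All.lookup x∉ (At⇒∈ p) refl)
  At-injective (_ ∷ uniq) (later p) (later q) = cong suc (At-injective uniq p q)

  lookup-At : ∀ xs (f : Fin (length xs)) → At xs (toℕ f) (lookup xs f)
  lookup-At (x ∷ xs) Fin.zero    = first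
  lookup-At (x ∷ xs) (Fin.suc f) = later (lookup-At xs f)

  At⇒lookup : ∀ {xs i x} → At xs i x → ∃[ f ] (toℕ f ≡ i × lookup xs f ≡ x)
  At⇒lookup first = Fin.zero , refl , refl
  At⇒lookup (later p) with f , refl , refl ← At⇒lookup p = Fin.suc f , refl , refl

  At-++ˡ : ∀ {xs i x} ys → At xs i x → At (xs ++ ys) i x
  At-++ˡ ys first     = first
  At-++ˡ ys (later p) = later (At-++ˡ ys p)

  At-last : ∀ xs y → At (xs ++ y ∷ []) (length xs) y
  At-last []       y = first
  At-last (x ∷ xs) y = later (At-last xs y)

  ∈-take⇒At : ∀ n xs {x} → x ∈ take n xs → ∃[ i ] (i < n × At xs i x)
  ∈-take⇒At (suc n) (y ∷ xs) (here refl) = 0 , s≤s z≤n , first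
  ∈-take⇒At (suc n) (y ∷ xs) (there x∈)
    with i , i<n , p ← ∈-take⇒At n xs x∈ = suc i , s≤s i<n , later p

  ∈-drop⇒At : ∀ n xs {x} → x ∈ drop n xs → ∃[ i ] (n ≤ i × At xs i x)
  ∈-drop⇒At zero    xs       x∈ with i , p ← ∈⇒At x∈ = i , z≤n , p
  ∈-drop⇒At (suc n) (y ∷ xs) x∈
    with i , n≤i , p ← ∈-drop⇒At n xs x∈ = suc i , s≤s n≤i , later p

  lookup-≡ : ∀ {xs i y} (l : Fin (length xs)) → toℕ l ≡ i → At xs i y → lookup xs l ≡ y
  lookup-≡ {xs} l refl p = At-functional (lookup-At xs l) p

  take-⊆ : ∀ n xs → take n xs ⊆ xs
  take-⊆ n xs x∈ = At⇒∈ (proj₂ (proj₂ (∈-take⇒At n xs x∈)))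

  drop-⊆ : ∀ n xs → drop n xs ⊆ xs
  drop-⊆ n xs x∈ = At⇒∈ (proj₂ (proj₂ (∈-drop⇒At n xs x∈)))

  take-++-drop-⊆ : ∀ n m xs → take n xs ++ drop m xs ⊆ xs
  take-++-drop-⊆ n m xs = [ take-⊆ n xs , drop-⊆ m xs ]′ ∘ ∈-++⁻ (take n xs)

  length-take-++-drop : ∀ {n m} (xs : List A) → n < m → m ≤ length xs →
                        length (take n xs ++ drop m xs) < length xs
  length-take-++-drop {n} {m} xs n<m m≤len = begin-strict
    length (take n xs ++ drop m xs)          ≡⟨ length-++ (take n xs) ⟩
    length (take n xs) + length (drop m xs)  ≡⟨ cong₂ _+_ (length-take n xs) (length-drop m xs) ⟩
    n ⊓ length xs + (length xs ∸ m)          ≤⟨ +-monoˡ-≤ (length xs ∸ m) (m⊓n≤m n (length xs)) ⟩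
    n + (length xs ∸ m)                      <⟨ +-monoˡ-< (length xs ∸ m) n<m ⟩
    m + (length xs ∸ m)                      ≡⟨ m+[n∸m]≡n m≤len ⟩
    length xs                                ∎
    where open ≤-Reasoning

module Walks {n : ℕ} (G : Graph n) where

  private
    V = Fin n

  data WalkFromTo : V → V → List V → Set where
    stop : ∀ {a} → WalkFromTo a a (a ∷ [])
    _∷_  : ∀ {a c b xs} → Adj G a c → WalkFromTo c b xs → WalkFromTo a b (a ∷ xs)

  adjacent⇒≢ : ∀ {x y} → Adj G x y → x ≢ y
  adjacent⇒≢ xy refl = irrefl G xy

  toWalk : ∀ {a b xs} → WalkFromTo a b xs → Walk G xs
  toWalk stop             = [ _ ]
  toWalk (ac ∷ stop)      = ac ∷ [ _ ]
  toWalk (ac ∷ w@(_ ∷ _)) = ac ∷ toWalk w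

  fromPathSeq : ∀ a mid b → Walk G (pathSeq G a mid b) → WalkFromTo a b (pathSeq G a mid b)
  fromPathSeq a []      b (ab ∷ [ _ ]) = ab ∷ stop
  fromPathSeq a (c ∷ mid) b (ac ∷ w)   = ac ∷ fromPathSeq c mid b w

  start-At : ∀ {a b xs} → WalkFromTo a b xs → At xs 0 a
  start-At stop    = first
  start-At (_ ∷ _) = first

  end-At : ∀ {a b xs} → WalkFromTo a b xs → ∃[ m ] (suc m ≡ length xs × At xs m b)
  end-At stop = 0 , refl , first
  end-At (_ ∷ w) with m , m+1≡len , p ← end-At w = suc m , cong suc m+1≡len , later p

  consecutive-adjacent : ∀ {a b xs i x y} → WalkFromTo a b xs →
                         At xs i x → At xs (suc i) y → Adj G x y
  consecutive-adjacent (ac ∷ w) first (later q)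
    with refl ← At-functional (start-At w) q = ac
  consecutive-adjacent (_ ∷ w) (later p) (later q) = consecutive-adjacent w p q

  take-walk : ∀ {a b xs i y} → WalkFromTo a b xs → At xs i y → WalkFromTo a y (take (suc i) xs)
  take-walk stop     first     = stop
  take-walk (_ ∷ _)  first     = stop
  take-walk (ac ∷ w) (later p) = ac ∷ take-walk w p

  drop-walk : ∀ {a b xs i y} → WalkFromTo a b xs → At xs i y → WalkFromTo y b (drop i xs)
  drop-walk stop     first     = stop
  drop-walk (ac ∷ w) first     = ac ∷ w
  drop-walk (_ ∷ w)  (later p) = drop-walk w p

  append-via : ∀ {a x y b ps qs} → WalkFromTo a x ps → Adj G x y → WalkFromTo y b qs →
               WalkFromTo a b (ps ++ qs)
  append-via stop     xy w = xy ∷ w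
  append-via (ac ∷ v) xy w = ac ∷ append-via v xy w

  concat-walk : ∀ {a b c ps qs} → WalkFromTo a b ps → WalkFromTo b c qs →
                WalkFromTo a c (ps ++ drop 1 qs)
  concat-walk stop     stop     = stop
  concat-walk stop     (bd ∷ w) = bd ∷ w
  concat-walk (ac ∷ v) w        = ac ∷ concat-walk v w

  reverse-walk : ∀ {a b xs} → WalkFromTo a b xs → WalkFromTo b a (reverse xs)
  reverse-walk stop = stop
  reverse-walk {a} (_∷_ {xs = xs} ac w) rewrite unfold-reverse a xs =
    append-via (reverse-walk w) (sym G ac) stop

  open DecMembership (Fin._≟_ {n}) using (_∈?_)

  walk-length≥3 : ∀ {a b xs} → a ≢ b → ¬ Adj G a b → WalkFromTo a b xs → 3 ≤ length xs
  walk-length≥3 a≢b _   stop            = ⊥-elim (a≢b refl)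
  walk-length≥3 _   a≁b (ab ∷ stop)     = ⊥-elim (a≁b ab)
  walk-length≥3 _   _   (_ ∷ _ ∷ stop)  = s≤s (s≤s (s≤s z≤n))
  walk-length≥3 _   _   (_ ∷ _ ∷ _ ∷ _) = s≤s (s≤s (s≤s z≤n))

  shortcut : ∀ {a b xs i j x y} → WalkFromTo a b xs → At xs i x → At xs j y → Adj G x y →
             WalkFromTo a b (take (suc i) xs ++ drop j xs)
  shortcut w p q xy = append-via (take-walk w p) xy (drop-walk w q)

  path-of-walk : ∀ {a b xs} → WalkFromTo a b xs →
                 ∃[ ys ] (WalkFromTo a b ys × Unique ys × length ys ≤ length xs × ys ⊆ xs)
  path-of-walk stop = _ , stop , [] ∷ [] , ≤-refl , λ x∈ → x∈
  path-of-walk {a} {xs = _ ∷ xs} (ac ∷ w)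
    with ys , w′ , uniq , ys≤xs , ys⊆xs ← path-of-walk w | a ∈? ys
  ... | yes a∈ys with i , p ← ∈⇒At a∈ys =
    drop i ys , drop-walk w′ p , drop⁺ i uniq , drop≤ , there ∘ ys⊆xs ∘ drop-⊆ i ys
    where
    drop≤ : length (drop i ys) ≤ suc (length xs)
    drop≤ = ≤-trans (≤-reflexive (length-drop i ys)) (≤-trans (m∸n≤m _ i) (m≤n⇒m≤1+n ys≤xs))
  ... | no a∉ys = a ∷ ys , ac ∷ w′ , ¬Any⇒All¬ ys a∉ys ∷ uniq , s≤s ys≤xs , ∷⁺ʳ a ys⊆xs

  cycle-through : ∀ {v a b ys} → Adj G v a → Adj G v b → ¬ v ∈ ys → Unique ys →
                  WalkFromTo a b ys → 2 ≤ length ys → IsCycle G (v ∷ ys)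
  cycle-through {v} {ys = ys} va vb v∉ys uniq w len≥2 with m , m+1≡len , b-at ← end-At w =
    s≤s len≥2 , (toWalk (va ∷ w) , ¬Any⇒All¬ ys v∉ys ∷ uniq) , closes
    where
    closes : (l : Fin (length (v ∷ ys))) → suc (toℕ l) ≡ length (v ∷ ys) →
             Adj G (lookup (v ∷ ys) l) v
    closes l l+1≡len = subst (λ x → Adj G x v) (≡.sym l-is-b) (sym G vb)
      where
      l-is-b = lookup-≡ l (≡.trans (suc-injective l+1≡len) (≡.sym m+1≡len)) (later b-at)

module ChordalSeparation {n : ℕ} (G : Graph n) (chordal : Chordal G) where

  open Walks G
  open DecMembership (Fin._≟_ {n}) using (_∈?_)

  private
    V = Fin n

  module _ {v a b : V} (va : Adj G v a) (vb : Adj G v b) (a≢b : a ≢ b) (a≁b : ¬ Adj G a b) where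

    Meets : List V → Set
    Meets xs = ∃[ x ] (x ∈ xs × x ≢ a × x ≢ b × N[_] G v x)

    meets-⊆ : ∀ {xs ys} → xs ⊆ ys → Meets xs → Meets ys
    meets-⊆ xs⊆ys (x , x∈xs , x≢a , x≢b , x∈N[v]) = x , xs⊆ys x∈xs , x≢a , x≢b , x∈N[v]

    chord-meets : ∀ {ys} → WalkFromTo a b ys → Unique ys →
                  (∀ {zs} → length zs < length ys → WalkFromTo a b zs → Meets zs) →
                  HasChord G (v ∷ ys) → Meets ys
    chord-meets {ys} path uniq shorter-meets (i , j , i+1<j , not-closing , xy) =
      meets-at (lookup-At (v ∷ ys) i) (lookup-At (v ∷ ys) j) i+1<j not-closing xy
      where
      end = end-At path

      meets-at : ∀ {i j x y} → At (v ∷ ys) i x → At (v ∷ ys) j y → suc i < j →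
                 ¬ (i ≡ 0 × suc j ≡ length (v ∷ ys)) → Adj G x y → Meets ys
      meets-at first (later q) (s≤s 0<j) not-closing vy = _ , At⇒∈ q , y≢a , y≢b , inj₂ vy
        where
        y≢a : _ ≢ a
        y≢a refl = <⇒≢ 0<j (≡.sym (At-injective uniq q (start-At path)))
        y≢b : _ ≢ b
        y≢b refl with refl ← At-injective uniq q (proj₂ (proj₂ end)) =
          not-closing (refl , cong suc (proj₁ (proj₂ end)))
      meets-at (later {i = i} p) (later {i = j} q) (s≤s i+1<j) _ xy =
        meets-⊆ (take-++-drop-⊆ (suc i) j ys) (shorter-meets shorter (shortcut path p q xy))
        where
        shorter = length-take-++-drop ys i+1<j (<⇒≤ (At⇒< q))

    path-meets : ∀ {ys} → WalkFromTo a b ys → Unique ys →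
                 (∀ {zs} → length zs < length ys → WalkFromTo a b zs → Meets zs) → Meets ys
    path-meets {ys} path uniq shorter-meets with v ∈? ys
    ... | yes v∈ys = v , v∈ys , adjacent⇒≢ va , adjacent⇒≢ vb , inj₁ refl
    ... | no v∉ys = chord-meets path uniq shorter-meets (chordal (v ∷ ys) cycle (s≤s len≥3))
      where
      len≥3 = walk-length≥3 a≢b a≁b path
      cycle = cycle-through va vb v∉ys uniq path (<⇒≤ len≥3)

    walk-meets : ∀ {xs} → Acc _<_ (length xs) → WalkFromTo a b xs → Meets xs
    walk-meets (acc smaller) w with ys , path , uniq , ys≤xs , ys⊆xs ← path-of-walk w =
      meets-⊆ ys⊆xs (path-meets path uniq λ shorter → walk-meets (smaller (≤-trans shorter ys≤xs)))

    closedNeighbourhood-separates : ∀ {xs} → WalkFromTo a b xs → Meets xs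
    closedNeighbourhood-separates = walk-meets (<-wellFounded _)

module InducedPath {n : ℕ} (G : Graph n) {L : List (Fin n)} (induced : IsInducedPath G L) where

  nonconsecutive-nonadjacent : ∀ {i j x y} → At L i x → At L j y → suc i < j → ¬ Adj G x y
  nonconsecutive-nonadjacent p q
    with f , refl , refl ← At⇒lookup p | g , refl , refl ← At⇒lookup q = proj₂ induced f g

  adjacent⇒close : ∀ {i j x y} → At L i x → At L j y → Adj G x y → j ≤ suc i
  adjacent⇒close p q xy = ≮⇒≥ λ i+1<j → nonconsecutive-nonadjacent p q i+1<j xy

  closedNeighbourhood-window : ∀ {k v i x} → At L (suc k) v → At L i x → N[_] G v x →
                               k ≤ i × i ≤ suc (suc k)
  closedNeighbourhood-window {k} v-at x-at (inj₁ refl)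
    with refl ← At-injective (proj₂ (proj₁ induced)) x-at v-at = n≤1+n k , n≤1+n (suc k)
  closedNeighbourhood-window v-at x-at (inj₂ vx) =
    ≤-pred (adjacent⇒close x-at v-at (sym G vx)) , adjacent⇒close v-at x-at vx

module InducedPathThrough {n : ℕ} (G : Graph n) (chordal : Chordal G)
  {u r v : Fin n} {mid : List (Fin n)} (induced : IsInducedPath G (pathSeq G u mid r)) (v∈mid : v ∈ mid) where

  open Walks G
  open ChordalSeparation G chordal
  open InducedPath G induced

  private
    L = pathSeq G u mid r
    uniq = proj₂ (proj₁ induced)
    walkL = fromPathSeq u mid r (proj₁ (proj₁ induced))
    k = proj₁ (∈⇒At v∈mid)
    v-at-mid = proj₂ (∈⇒At v∈mid)

    k<|mid| : k < length mid
    k<|mid| = At⇒< v-at-mid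

    v-at : At L (suc k) v
    v-at = later (At-++ˡ (r ∷ []) v-at-mid)

    r-at : At L (suc (length mid)) r
    r-at = later (At-last mid r)

    a-exists = <⇒At L (<⇒≤ (At⇒< v-at))
    b-exists = <⇒At L (≤-<-trans (s≤s k<|mid|) (At⇒< r-at))
    a = proj₁ a-exists
    b = proj₁ b-exists
    a-at = proj₂ a-exists
    b-at = proj₂ b-exists

    va : Adj G v a
    va = sym G (consecutive-adjacent walkL a-at v-at)

    vb : Adj G v b
    vb = consecutive-adjacent walkL v-at b-at

    b≢a : b ≢ a
    b≢a b≡a = <⇒≢ (m<n⇒m<1+n (n<1+n k)) (At-injective uniq a-at (subst (At L (suc (suc k))) b≡a b-at))

    b≁a : ¬ Adj G b a
    b≁a = nonconsecutive-nonadjacent a-at b-at ≤-refl ∘ sym G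

  -- x lies on L and differs from v
  OnEitherSide : Fin n → Set
  OnEitherSide x = ∃[ i ] (At L i x × (i ≤ k ⊎ suc (suc k) ≤ i))

  onEitherSide-∉N[v] : ∀ {x} → OnEitherSide x → x ≢ a → x ≢ b → ¬ N[_] G v x
  onEitherSide-∉N[v] (i , x-at , off) x≢a x≢b x∈N[v] with closedNeighbourhood-window v-at x-at x∈N[v]
  ... | k≤i , i≤k+2 with off
  ...   | inj₁ i≤k with refl ← ≤-antisym i≤k k≤i = x≢a (At-functional x-at a-at)
  ...   | inj₂ k+2≤i with refl ← ≤-antisym i≤k+2 k+2≤i = x≢b (At-functional x-at b-at)

  u-off : OnEitherSide u
  u-off = 0 , first , inj₁ z≤n

  r-off : OnEitherSide r
  r-off = suc (length mid) , r-at , inj₂ (s≤s k<|mid|)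

  locate : ∀ {mid′ x} → x ∈ pathSeq G u mid′ r → x ∈ mid′ ⊎ OnEitherSide x
  locate (here refl) = inj₂ u-off
  locate {mid′} (there x∈) with ∈-++⁻ mid′ x∈
  ... | inj₁ x∈mid′      = inj₁ x∈mid′
  ... | inj₂ (here refl) = inj₂ r-off

  Detour : List (Fin n) → List (Fin n)
  Detour mid′ = (drop (suc (suc k)) L ++ drop 1 (reverse (pathSeq G u mid′ r))) ++ drop 1 (take (suc k) L)

  detour-walk : ∀ {mid′} → PathBetween G u r mid′ → WalkFromTo b a (Detour mid′)
  detour-walk {mid′} (walkQ , _) =
    concat-walk (concat-walk (drop-walk walkL b-at) (reverse-walk (fromPathSeq u mid′ r walkQ)))
                (take-walk walkL a-at)

  locate-detour : ∀ mid′ {x} → x ∈ Detour mid′ → x ∈ mid′ ⊎ OnEitherSide x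
  locate-detour mid′ x∈ with ∈-++⁻ (drop (suc (suc k)) L ++ _) x∈
  ... | inj₂ x∈prefix with i , i≤k , x-at ← ∈-take⇒At (suc k) L (drop-⊆ 1 _ x∈prefix) =
    inj₂ (i , x-at , inj₁ (≤-pred i≤k))
  ... | inj₁ x∈ with ∈-++⁻ (drop (suc (suc k)) L) x∈
  ...   | inj₁ x∈suffix with i , k+2≤i , x-at ← ∈-drop⇒At (suc (suc k)) L x∈suffix =
    inj₂ (i , x-at , inj₂ k+2≤i)
  ...   | inj₂ x∈Q = locate (reverse⁻ (drop-⊆ 1 _ x∈Q))

  meets-interior : ∀ {mid′} → PathBetween G u r mid′ →
                   ∃[ w ] (w ∈ mid′ × N[_] G v w × w ≢ r × w ≢ u)
  meets-interior {mid′} Q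
    with x , x∈xs , x≢b , x≢a , x∈N[v] ← closedNeighbourhood-separates vb va b≢a b≁a (detour-walk Q)
    with locate-detour mid′ x∈xs
  ... | inj₂ off      = ⊥-elim (onEitherSide-∉N[v] off x≢a x≢b x∈N[v])
  ... | inj₁ x∈mid′ = x , x∈mid′ , x∈N[v] , x≢r , x≢u
    where
    x≢r : x ≢ r
    x≢r refl = onEitherSide-∉N[v] r-off x≢a x≢b x∈N[v]
    x≢u : x ≢ u
    x≢u refl = onEitherSide-∉N[v] u-off x≢a x≢b x∈N[v]

lemma19 : {n : ℕ} (G : Graph n) → Chordal G →
    (r v u : Fin n) → r ≢ v → v ≢ u → r ≢ u →
    (∃[ mid ] IsInducedPath G (pathSeq G u mid r) × v ∈ mid) →
    ((mid : List (Fin n)) → PathBetween G u r mid →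
       ∃[ w ] (w ∈ pathSeq G u mid r × N[_] G v w))
    × ((mid : List (Fin n)) → PathBetween G u r mid →
       ∃[ w ] (w ∈ mid × N[_] G v w × w ≢ r × w ≢ u))
-- The distinctness hypotheses already follow from v ∈ mid and the path being induced.
lemma19 G chordal r v u _ _ _ (mid , induced , v∈mid) = meets-path , λ _ → meets-interior
  where
  open InducedPathThrough G chordal induced v∈mid using (meets-interior)

  meets-path : (mid′ : List _) → PathBetween G u r mid′ → ∃[ w ] (w ∈ pathSeq G u mid′ r × N[_] G v w)
  meets-path mid′ Q with w , w∈mid′ , w∈N[v] , _ ← meets-interior Q = w , there (∈-++⁺ˡ w∈mid′) , w∈N[v]
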